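{- Let $p=5$, $q=25$, $f(x)=x^8+x^6+x^2$, $\xi\in\mathbb{F}_{25}$ a root of $x^2+4x+2$ and $\lambda=\xi+2$ (so $\lambda^4=-1$), with Teichmüller lift $\hat\lambda\in\mathbb{Z}_{25}$. Define $F_i(\pi)\in\mathbb{Z}_{25}[\pi]$ by $E(\hat\lambda\pi x^8)E(\hat\lambda\pi x^6)E(\hat\lambda\pi x^2)=\sum_{i\ge0}F_i(\pi)x^i$ (with $F_i=0$ for $i<0$), let $A=(F_{5i-j}(\pi))_{i,j\ge1}$ and $M=A\,\tau(A)$, where $\tau$ is the Frobenius of $\mathbb{Q}_{25}/\mathbb{Q}_5$ acting coefficientwise and fixing $\pi$. Then for every $k\ge1$, $\mathrm{Tr}(M^k)$, as a formal power series in $\pi$, has nonzero coefficients only in even powers of $\pi$.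
   Context: $E(x)=\exp\big(\sum_{i\ge0}x^{5^i}/5^i\big)\in\mathbb{Z}_5[[x]]$ is the Artin–Hasse exponential, $\pi$ is a formal variable, and $\mathbb{Z}_{25}$ is the ring of integers of the unramified quadratic extension $\mathbb{Q}_{25}$ of $\mathbb{Q}_5$. Note $\tau(\hat\lambda)=\hat\lambda^5$. -}

module Defs where

open import Data.Nat as ℕ using (ℕ; zero; suc; _∸_; _^_; _≡ᵇ_; _≤ᵇ_)
open import Data.Integer using (+_)
open import Data.Rational as ℚ using (ℚ; 0ℚ; 1ℚ)
open import Data.Bool using (Bool; true; false; if_then_else_)

sumTo : {A : Set} → A → (A → A → A) → ℕ → (ℕ → A) → A
sumTo z _⊕_ zero    f = z
sumTo z _⊕_ (suc n) f = sumTo z _⊕_ n f ⊕ f n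

conv : {A : Set} → A → (A → A → A) → (A → A → A) →
       (ℕ → A) → (ℕ → A) → ℕ → A
conv z _⊕_ _⊗_ f g n = sumTo z _⊕_ (suc n) (λ j → f j ⊗ g (n ∸ j))

-- Formal exponential over ℚ of a series g with g 0 = 0, via the
-- standard recursion  m h_m = Σ_{j=1}^{m} j g_j h_{m-j},  h_0 = 1
-- (i.e. h' = g' h, h(0) = 1).  expTab g m j = h_j for j ≤ m.

expTab : (ℕ → ℚ) → ℕ → ℕ → ℚ
expTab g zero    j = if j ≡ᵇ 0 then 1ℚ else 0ℚ
expTab g (suc m) j =
  if j ≡ᵇ suc m
  then (+ 1 ℚ./ suc m) ℚ.*
       sumTo 0ℚ ℚ._+_ (suc m)
         (λ j' → (+ suc j' ℚ./ 1) ℚ.* g (suc j') ℚ.* expTab g m (m ∸ j'))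
  else expTab g m j

fexp : (ℕ → ℚ) → ℕ → ℚ
fexp g n = expTab g n n

ahLog : ℕ → ℚ
ahLog j = sumTo 0ℚ ℚ._+_ (suc j)
  (λ i → if (5 ^ i) ≡ᵇ j then (+ 1 ℚ./ (5 ^ i)) {{m^n≢0 5 i}} else 0ℚ)
  where open import Data.Nat.Properties using (m^n≢0)

-- Artin–Hasse exponential coefficients: E(x) = Σ ahE n x^n
ahE : ℕ → ℚ
ahE = fexp ahLog

-- K = ℚ(ζ₈) = ℚ[t]/(t⁴+1), elements a₀ + a₁ t + a₂ t² + a₃ t³.
-- t plays the role of the Teichmüller lift λ̂ (a primitive 8th root
-- of unity in ℤ₂₅).

record K : Set where
  constructor mkK
  field c0 c1 c2 c3 : ℚ

0K 1K tK : K
0K = mkK 0ℚ 0ℚ 0ℚ 0ℚ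
1K = mkK 1ℚ 0ℚ 0ℚ 0ℚ
tK = mkK 0ℚ 1ℚ 0ℚ 0ℚ

infixl 6 _+K_
infixl 7 _*K_
_+K_ : K → K → K
mkK a0 a1 a2 a3 +K mkK b0 b1 b2 b3 =
  mkK (a0 ℚ.+ b0) (a1 ℚ.+ b1) (a2 ℚ.+ b2) (a3 ℚ.+ b3)

-- multiplication using t⁴ = -1
_*K_ : K → K → K
mkK a0 a1 a2 a3 *K mkK b0 b1 b2 b3 =
  mkK (a0 ℚ.* b0 ℚ.- (a1 ℚ.* b3 ℚ.+ a2 ℚ.* b2 ℚ.+ a3 ℚ.* b1))
      (a0 ℚ.* b1 ℚ.+ a1 ℚ.* b0 ℚ.- (a2 ℚ.* b3 ℚ.+ a3 ℚ.* b2))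
      (a0 ℚ.* b2 ℚ.+ a1 ℚ.* b1 ℚ.+ a2 ℚ.* b0 ℚ.- a3 ℚ.* b3)
      (a0 ℚ.* b3 ℚ.+ a1 ℚ.* b2 ℚ.+ a2 ℚ.* b1 ℚ.+ a3 ℚ.* b0)

scalK : ℚ → K → K
scalK r (mkK a0 a1 a2 a3) = mkK (r ℚ.* a0) (r ℚ.* a1) (r ℚ.* a2) (r ℚ.* a3)

powK : K → ℕ → K
powK x zero    = 1K
powK x (suc n) = powK x n *K x

-- Frobenius τ: the ℚ-automorphism with τ(t) = t⁵ (= -t)
τK : K → K
τK x = let open K x in
  (((scalK c0 1K +K scalK c1 (powK tK 5)) +K scalK c2 (powK (powK tK 5) 2))
     +K scalK c3 (powK (powK tK 5) 3))

-- Formal power series in π over K : coefficient sequences ℕ → K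

PS : Set
PS = ℕ → K

0PS 1PS : PS
0PS n = 0K
1PS zero    = 1K
1PS (suc n) = 0K

_+PS_ : PS → PS → PS
(f +PS g) n = f n +K g n

_*PS_ : PS → PS → PS
_*PS_ = conv 0K _+K_ _*K_

τPS : PS → PS
τPS f n = τK (f n)

-- Power series in x with coefficients in K[[π]] : ℕ → PS

XS : Set
XS = ℕ → PS

_*XS_ : XS → XS → XS
_*XS_ = conv 0PS _+PS_ _*PS_

-- E(λ̂ π x^m) = Σ_n ahE n · λ̂^n π^n x^(m n)
Esub : ℕ → XS
Esub m i n = if (m ℕ.* n) ≡ᵇ i then scalK (ahE n) (powK tK n) else 0K

F : ℕ → PS
F = (Esub 8 *XS Esub 6) *XS Esub 2

-- N×N truncations of the infinite matrices (0-based indices i, j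
-- stand for the paper's indices i+1, j+1).

-- an N×N matrix is given by its entries at indices i, j < N
-- (entries outside this range are never used)
Mat : Set
Mat = ℕ → ℕ → PS

-- A_{ij} = F_{5i-j}  (paper indices i,j ≥ 1; F_m = 0 for m < 0)
Amat : ℕ → Mat
Amat N i j = if suc j ≤ᵇ 5 ℕ.* suc i then F (5 ℕ.* suc i ∸ suc j) else 0PS

τMat : Mat → Mat
τMat X i j = τPS (X i j)

mmul : (N : ℕ) → Mat → Mat → Mat
mmul N X Y i j = sumTo 0PS _+PS_ N (λ l → X i l *PS Y l j)

idMat : Mat
idMat i j = if i ≡ᵇ j then 1PS else 0PS

mpow : (N : ℕ) → Mat → ℕ → Mat
mpow N X zero    = idMat
mpow N X (suc k) = mmul N (mpow N X k) X

trace : (N : ℕ) → Mat → PS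
trace N X = sumTo 0PS _+PS_ N (λ i → X i i)

Mmat : ℕ → Mat
Mmat N = mmul N (Amat N) (τMat (Amat N))

trMk : ℕ → ℕ → PS
trMk N k = trace N (mpow N (Mmat N) k)

{-# OPTIONS --safe #-}
-- Since τ(λ̂) = λ̂⁵ = −λ̂ and the coefficient of πⁿ in every F_i is a rational multiple
-- of λ̂ⁿ, applying τ to A has the same effect as the substitution ε : π ↦ −π.  Both τ
-- and ε are ring endomorphisms of K[[π]] and ε is an involution, so
--   ε(M) = ε(A) ε(τA) = τ(A) ε(εA) = τ(A) A,
-- and cyclicity of the trace gives ε(Tr Mᵏ) = Tr((τA·A)ᵏ) = Tr((A·τA)ᵏ) = Tr Mᵏ.
-- Hence every odd coefficient c of Tr Mᵏ satisfies c = −c, so c = 0.  Nothing here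
-- depends on the truncation size N.
module Submission where

open import Defs
open import Data.Nat as ℕ using (ℕ; zero; suc; _∸_; _<_; _≤_; s≤s; _≡ᵇ_; _%_)
open import Data.Nat.Properties
  using ( _≟_; n<1+n; m<n⇒m<1+n; <⇒≢; ≤∧≢⇒<; ≤-pred; ≡ᵇ⇒≡; ≡⇒≡ᵇ
        ; +-∸-assoc; n∸n≡0; m+[n∸m]≡n; m∸[m∸n]≡n; m+n∸m≡n; ∸-+-assoc )
open import Data.Bool using (true; false; if_then_else_)
open import Data.Product using (_,_; ∃-syntax)
open import Function using (_$_)
open import Level using (0ℓ)
open import Relation.Binary.Core using (Rel)
open import Relation.Binary.Bundles using (Setoid)
open import Data.Empty using (⊥-elim)
open import Relation.Binary.PropositionalEquality as ≡ using (_≡_; _≢_)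
open import Relation.Nullary using (yes; no)
open import Data.Rational as ℚ using (ℚ; 0ℚ; ½)
import Data.Rational.Properties as ℚ
open import Data.Rational.Solver using (module +-*-Solver)
open import Data.Vec using (Vec; []; _∷_)
open import Data.Fin using (#_)
open import Algebra.Bundles using (CommutativeMonoid; Semiring; CommutativeRing)
open import Algebra.Morphism.Structures using (module SemiringMorphisms)

module SumProperties {ℓ} (M : CommutativeMonoid 0ℓ ℓ) where

  open CommutativeMonoid M renaming (Carrier to A)
  open import Algebra.Properties.CommutativeSemigroup commutativeSemigroup using (interchange)
  open import Relation.Binary.Reasoning.Setoid setoid

  Σ : ℕ → (ℕ → A) → A
  Σ = sumTo ε _∙_

  sum-cong : ∀ n {f g : ℕ → A} → (∀ j → j < n → f j ≈ g j) → Σ n f ≈ Σ n g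
  sum-cong zero    f≈g = refl
  sum-cong (suc n) f≈g =
    ∙-cong (sum-cong n (λ j j<n → f≈g j (m<n⇒m<1+n j<n))) (f≈g n (n<1+n n))

  sum-ε : ∀ n {f : ℕ → A} → (∀ j → j < n → f j ≈ ε) → Σ n f ≈ ε
  sum-ε zero    f≈ε = refl
  sum-ε (suc n) f≈ε = trans (∙-cong (sum-ε n (λ j j<n → f≈ε j (m<n⇒m<1+n j<n))) (f≈ε n (n<1+n n)))
                            (identityˡ ε)

  sum-∙ : ∀ n (f g : ℕ → A) → Σ n (λ j → f j ∙ g j) ≈ Σ n f ∙ Σ n g
  sum-∙ zero    f g = sym (identityˡ ε)
  sum-∙ (suc n) f g = trans (∙-congʳ (sum-∙ n f g)) (interchange _ _ _ _)

  sum-swap : ∀ m n (f : ℕ → ℕ → A) → Σ m (λ i → Σ n (f i)) ≈ Σ n (λ j → Σ m (λ i → f i j))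
  sum-swap zero    n f = sym (sum-ε n (λ _ _ → refl))
  sum-swap (suc m) n f = trans (∙-congʳ (sum-swap m n f)) (sym (sum-∙ n _ _))

  sum-unconsˡ : ∀ n (f : ℕ → A) → Σ (suc n) f ≈ f 0 ∙ Σ n (λ j → f (suc j))
  sum-unconsˡ zero    f = comm ε (f 0)
  sum-unconsˡ (suc n) f = trans (∙-congʳ (sum-unconsˡ n f)) (assoc _ _ _)

  sum-reverse : ∀ n (f : ℕ → A) → Σ n f ≈ Σ n (λ j → f (n ∸ suc j))
  sum-reverse zero    f = refl
  sum-reverse (suc n) f = begin
    Σ (suc n) f                              ≈⟨ sum-unconsˡ n f ⟩
    f 0 ∙ Σ n (λ j → f (suc j))              ≈⟨ ∙-congˡ (sum-reverse n (λ j → f (suc j))) ⟩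
    f 0 ∙ Σ n (λ j → f (suc (n ∸ suc j)))    ≈⟨ comm _ _ ⟩
    Σ n (λ j → f (suc (n ∸ suc j))) ∙ f 0    ≈⟨ ∙-cong
      (sum-cong n λ j j<n → reflexive (≡.cong f (≡.sym (+-∸-assoc 1 j<n))))
      (reflexive (≡.cong f (≡.sym (n∸n≡0 n)))) ⟩
    Σ (suc n) (λ j → f (suc n ∸ suc j))      ∎

  sum-pick : ∀ n i (f : ℕ → A) → i < n → (∀ j → j < n → j ≢ i → f j ≈ ε) → Σ n f ≈ f i
  sum-pick (suc n) i f (s≤s i≤n) f≈ε with i ≟ n
  ... | yes ≡.refl = trans (∙-congʳ (sum-ε n λ j j<n → f≈ε j (m<n⇒m<1+n j<n) (<⇒≢ j<n))) (identityˡ (f i))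
  ... | no i≢n     = trans (∙-cong (sum-pick n i f (≤∧≢⇒< i≤n i≢n) λ j j<n → f≈ε j (m<n⇒m<1+n j<n))
                                   (f≈ε n (n<1+n n) (≡.≢-sym i≢n)))
                            (identityʳ (f i))

  sum-triangle : ∀ n (b : ℕ → ℕ → A) →
    Σ (suc n) (λ m → Σ (suc m) (λ j → b j m)) ≈ Σ (suc n) (λ j → Σ (suc n ∸ j) (λ m → b j (j ℕ.+ m)))
  sum-triangle zero    b = refl
  sum-triangle (suc n) b = begin
    Σ (suc n) (λ m → Σ (suc m) (λ j → b j m)) ∙ Σ (suc (suc n)) (λ j → b j (suc n))
      ≈⟨ ∙-congʳ (sum-triangle n b) ⟩
    Σ (suc n) row ∙ Σ (suc (suc n)) (λ j → b j (suc n))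
      ≈⟨ ∙-congʳ (trans (∙-congˡ last-row-empty) (identityʳ _)) ⟨
    Σ (suc (suc n)) row ∙ Σ (suc (suc n)) (λ j → b j (suc n))
      ≈⟨ sum-∙ (suc (suc n)) row _ ⟨
    Σ (suc (suc n)) (λ j → row j ∙ b j (suc n))
      ≈⟨ sum-cong (suc (suc n)) extend-row ⟩
    Σ (suc (suc n)) (λ j → Σ (suc (suc n) ∸ j) (λ m → b j (j ℕ.+ m))) ∎
    where
    row : ℕ → A
    row j = Σ (suc n ∸ j) (λ m → b j (j ℕ.+ m))
    last-row-empty : row (suc n) ≈ ε
    last-row-empty = reflexive (≡.cong (λ k → Σ k (λ m → b (suc n) (suc n ℕ.+ m))) (n∸n≡0 n))
    extend-row : ∀ j → j < suc (suc n) → row j ∙ b j (suc n) ≈ Σ (suc (suc n) ∸ j) (λ m → b j (j ℕ.+ m))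
    extend-row j (s≤s j≤1+n) rewrite +-∸-assoc 1 j≤1+n =
      ∙-congˡ (reflexive (≡.cong (b j) (≡.sym (m+[n∸m]≡n j≤1+n))))

IsSemiringEndomorphism : ∀ {ℓ} (R : CommutativeRing 0ℓ ℓ) →
  (CommutativeRing.Carrier R → CommutativeRing.Carrier R) → Set ℓ
IsSemiringEndomorphism R = IsSemiringHomomorphism
  where open Semiring (CommutativeRing.semiring R) using (rawSemiring)
        open SemiringMorphisms rawSemiring rawSemiring

module RingProperties {ℓ} (R : CommutativeRing 0ℓ ℓ) where

  open CommutativeRing R
  open import Algebra.Properties.Ring ring using (-‿distribˡ-*; -‿distribʳ-*; -‿involutive; -0#≈0#; -‿+-comm)
  open SemiringMorphisms (Semiring.rawSemiring semiring) (Semiring.rawSemiring semiring) public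
    using (module IsSemiringHomomorphism)
  open SumProperties +-commutativeMonoid public
  open import Relation.Binary.Reasoning.Setoid setoid

  sum-distribˡ : ∀ n x (f : ℕ → Carrier) → x * Σ n f ≈ Σ n (λ j → x * f j)
  sum-distribˡ zero    x f = zeroʳ x
  sum-distribˡ (suc n) x f = trans (distribˡ x _ _) (+-congʳ (sum-distribˡ n x f))

  sum-distribʳ : ∀ n x (f : ℕ → Carrier) → Σ n f * x ≈ Σ n (λ j → f j * x)
  sum-distribʳ zero    x f = zeroˡ x
  sum-distribʳ (suc n) x f = trans (distribʳ x _ _) (+-congʳ (sum-distribʳ n x f))

  isSemiringEndomorphism : ∀ {φ} → (∀ {x y} → x ≈ y → φ x ≈ φ y) →
    (∀ x y → φ (x + y) ≈ φ x + φ y) → φ 0# ≈ 0# →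
    (∀ x y → φ (x * y) ≈ φ x * φ y) → φ 1# ≈ 1# → IsSemiringEndomorphism R φ
  isSemiringEndomorphism φ-cong +-homo 0#-homo *-homo 1#-homo = record
    { isNearSemiringHomomorphism = record
      { +-isMonoidHomomorphism = record
        { isMagmaHomomorphism = record { isRelHomomorphism = record { cong = φ-cong } ; homo = +-homo }
        ; ε-homo = 0#-homo }
      ; *-homo = *-homo }
    ; 1#-homo = 1#-homo }

  sum-homo : ∀ {φ} → IsSemiringEndomorphism R φ →
    ∀ n (f : ℕ → Carrier) → φ (Σ n f) ≈ Σ n (λ j → φ (f j))
  sum-homo φ-endo zero    f = 0#-homo where open IsSemiringHomomorphism φ-endo
  sum-homo φ-endo (suc n) f = trans (+-homo _ _) (+-congʳ (sum-homo φ-endo n f))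
    where open IsSemiringHomomorphism φ-endo

  signed : ℕ → Carrier → Carrier
  signed zero    x = x
  signed (suc n) x = - signed n x

  signed-cong : ∀ n {x y} → x ≈ y → signed n x ≈ signed n y
  signed-cong zero    x≈y = x≈y
  signed-cong (suc n) x≈y = -‿cong (signed-cong n x≈y)

  signed-0# : ∀ n → signed n 0# ≈ 0#
  signed-0# zero    = refl
  signed-0# (suc n) = trans (-‿cong (signed-0# n)) -0#≈0#

  signed-- : ∀ n x → signed n (- x) ≈ - signed n x
  signed-- zero    x = refl
  signed-- (suc n) x = -‿cong (signed-- n x)

  signed-+ : ∀ n x y → signed n (x + y) ≈ signed n x + signed n y
  signed-+ zero    x y = refl
  signed-+ (suc n) x y = trans (-‿cong (signed-+ n x y)) (sym (-‿+-comm _ _))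

  signed-*ʳ : ∀ n x y → x * signed n y ≈ signed n (x * y)
  signed-*ʳ zero    x y = refl
  signed-*ʳ (suc n) x y = trans (sym (-‿distribʳ-* x _)) (-‿cong (signed-*ʳ n x y))

  signed-*ˡ : ∀ n x y → signed n x * y ≈ signed n (x * y)
  signed-*ˡ n x y = trans (*-comm _ y) (trans (signed-*ʳ n y x) (signed-cong n (*-comm y x)))

  signed-* : ∀ m n x y → signed m x * signed n y ≈ signed (m ℕ.+ n) (x * y)
  signed-* zero    n x y = signed-*ʳ n x y
  signed-* (suc m) n x y = trans (sym (-‿distribˡ-* _ _)) (-‿cong (signed-* m n x y))

  signed-involutive : ∀ n x → signed n (signed n x) ≈ x
  signed-involutive zero    x = refl
  signed-involutive (suc n) x = begin
    - signed n (- signed n x)   ≈⟨ -‿cong (signed-- n (signed n x)) ⟩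
    - - signed n (signed n x)   ≈⟨ -‿involutive _ ⟩
    signed n (signed n x)       ≈⟨ signed-involutive n x ⟩
    x                           ∎

  signed-odd : ∀ n x → n % 2 ≡ 1 → signed n x ≈ - x
  signed-odd (suc zero)    x _   = refl
  signed-odd (suc (suc n)) x odd = trans (-‿involutive _) (signed-odd n x odd)

module PowerSeries {ℓ} (R : CommutativeRing 0ℓ ℓ) where

  open CommutativeRing R
  open RingProperties R
  open import Relation.Binary.Reasoning.Setoid setoid
  import Algebra.Construct.Pointwise ℕ as Pointwise

  Series : Set
  Series = ℕ → Carrier

  infix 4 _≋_
  _≋_ : Rel Series ℓ
  f ≋ g = ∀ n → f n ≈ g n

  0ₛ 1ₛ : Series
  0ₛ _ = 0#
  1ₛ zero    = 1#
  1ₛ (suc _) = 0#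

  -ₛ_ : Series → Series
  (-ₛ f) n = - f n

  _+ₛ_ _*ₛ_ : Series → Series → Series
  (f +ₛ g) n = f n + g n
  _*ₛ_ = conv 0# _+_ _*_

  *ₛ-cong : ∀ {f f′ g g′} → f ≋ f′ → g ≋ g′ → f *ₛ g ≋ f′ *ₛ g′
  *ₛ-cong f≋f′ g≋g′ n = sum-cong (suc n) λ j _ → *-cong (f≋f′ j) (g≋g′ (n ∸ j))

  *ₛ-comm : ∀ f g → f *ₛ g ≋ g *ₛ f
  *ₛ-comm f g n = trans (sum-reverse (suc n) _) (sum-cong (suc n) λ j j<1+n →
    trans (*-congˡ (reflexive (≡.cong g (m∸[m∸n]≡n (≤-pred j<1+n))))) (*-comm _ _))

  *ₛ-identityˡ : ∀ f → 1ₛ *ₛ f ≋ f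
  *ₛ-identityˡ f n = begin
    Σ (suc n) (λ j → 1ₛ j * f (n ∸ j))                  ≈⟨ sum-unconsˡ n _ ⟩
    1# * f n + Σ n (λ j → 0# * f (n ∸ suc j))           ≈⟨ +-cong (*-identityˡ (f n)) (sum-ε n λ j _ → zeroˡ _) ⟩
    f n + 0#                                            ≈⟨ +-identityʳ (f n) ⟩
    f n                                                 ∎

  *ₛ-distribʳ : ∀ h f g → (f +ₛ g) *ₛ h ≋ (f *ₛ h) +ₛ (g *ₛ h)
  *ₛ-distribʳ h f g n = trans (sum-cong (suc n) λ j _ → distribʳ _ _ _) (sum-∙ (suc n) _ _)

  *ₛ-assoc : ∀ f g h → (f *ₛ g) *ₛ h ≋ f *ₛ (g *ₛ h)
  *ₛ-assoc f g h n = begin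
    Σ (suc n) (λ m → Σ (suc m) (λ j → f j * g (m ∸ j)) * h (n ∸ m))
      ≈⟨ sum-cong (suc n) (λ m _ → sum-distribʳ (suc m) (h (n ∸ m)) _) ⟩
    Σ (suc n) (λ m → Σ (suc m) (λ j → (f j * g (m ∸ j)) * h (n ∸ m)))
      ≈⟨ sum-triangle n (λ j m → (f j * g (m ∸ j)) * h (n ∸ m)) ⟩
    Σ (suc n) (λ j → Σ (suc n ∸ j) (λ m → (f j * g ((j ℕ.+ m) ∸ j)) * h (n ∸ (j ℕ.+ m))))
      ≈⟨ sum-cong (suc n) factor-out ⟩
    Σ (suc n) (λ j → f j * Σ (suc (n ∸ j)) (λ m → g m * h ((n ∸ j) ∸ m)))
      ∎
    where
    factor-out : ∀ j → j < suc n →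
      Σ (suc n ∸ j) (λ m → (f j * g ((j ℕ.+ m) ∸ j)) * h (n ∸ (j ℕ.+ m))) ≈
      f j * Σ (suc (n ∸ j)) (λ m → g m * h ((n ∸ j) ∸ m))
    factor-out j (s≤s j≤n) rewrite +-∸-assoc 1 j≤n = begin
      Σ (suc (n ∸ j)) (λ m → (f j * g ((j ℕ.+ m) ∸ j)) * h (n ∸ (j ℕ.+ m)))
        ≈⟨ sum-cong (suc (n ∸ j)) (λ m _ → trans
             (reflexive (≡.cong₂ (λ u v → (f j * g u) * h v) (m+n∸m≡n j m) (≡.sym (∸-+-assoc n j m))))
             (*-assoc _ _ _)) ⟩
      Σ (suc (n ∸ j)) (λ m → f j * (g m * h ((n ∸ j) ∸ m)))
        ≈⟨ sum-distribˡ (suc (n ∸ j)) (f j) _ ⟨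
      f j * Σ (suc (n ∸ j)) (λ m → g m * h ((n ∸ j) ∸ m))
        ∎

  commutativeRing : CommutativeRing 0ℓ ℓ
  commutativeRing = record
    { Carrier = Series ; _≈_ = _≋_ ; _+_ = _+ₛ_ ; _*_ = _*ₛ_ ; -_ = -ₛ_ ; 0# = 0ₛ ; 1# = 1ₛ
    ; isCommutativeRing = record
      { isRing = record
        { +-isAbelianGroup = Pointwise.isAbelianGroup +-isAbelianGroup
        ; *-cong = *ₛ-cong
        ; *-assoc = *ₛ-assoc
        ; *-identity = *ₛ-identityˡ , λ f n → trans (*ₛ-comm f 1ₛ n) (*ₛ-identityˡ f n)
        ; distrib = (λ h f g n → trans (*ₛ-comm h (f +ₛ g) n) (trans (*ₛ-distribʳ h f g n)
                                   (+-cong (*ₛ-comm f h n) (*ₛ-comm g h n))))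
                  , *ₛ-distribʳ
        }
      ; *-comm = *ₛ-comm
      }
    }

  module Ring[[π]] = RingProperties commutativeRing

  map : (Carrier → Carrier) → Series → Series
  map φ f n = φ (f n)

  map-isSemiringEndomorphism : ∀ {φ} → IsSemiringEndomorphism R φ → IsSemiringEndomorphism commutativeRing (map φ)
  map-isSemiringEndomorphism {φ} φ-endo = Ring[[π]].isSemiringEndomorphism
    (λ f≋g n → ⟦⟧-cong (f≋g n)) (λ f g n → +-homo (f n) (g n)) (λ _ → 0#-homo)
    (λ f g n → trans (sum-homo φ-endo (suc n) _) (sum-cong (suc n) λ j _ → *-homo _ _)) map-1ₛ
    where
    open IsSemiringHomomorphism φ-endo
    map-1ₛ : map φ 1ₛ ≋ 1ₛ
    map-1ₛ zero    = 1#-homo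
    map-1ₛ (suc _) = 0#-homo

  homomorphisms-agree-*ₛ : ∀ {φ ψ} → IsSemiringEndomorphism R φ → IsSemiringEndomorphism R ψ →
    ∀ {f g} → map φ f ≋ map ψ f → map φ g ≋ map ψ g → map φ (f *ₛ g) ≋ map ψ (f *ₛ g)
  homomorphisms-agree-*ₛ {φ} {ψ} φ-endo ψ-endo {f} {g} f-agree g-agree n = begin
    map φ (f *ₛ g) n           ≈⟨ φ[[π]].*-homo f g n ⟩
    (map φ f *ₛ map φ g) n     ≈⟨ *ₛ-cong f-agree g-agree n ⟩
    (map ψ f *ₛ map ψ g) n     ≈⟨ ψ[[π]].*-homo f g n ⟨
    map ψ (f *ₛ g) n           ∎
    where
    module φ[[π]] = Ring[[π]].IsSemiringHomomorphism (map-isSemiringEndomorphism φ-endo)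
    module ψ[[π]] = Ring[[π]].IsSemiringHomomorphism (map-isSemiringEndomorphism ψ-endo)

  -- The substitution ε : π ↦ −π.
  alternate : Series → Series
  alternate f n = signed n (f n)

  alternate-isSemiringEndomorphism : IsSemiringEndomorphism commutativeRing alternate
  alternate-isSemiringEndomorphism = Ring[[π]].isSemiringEndomorphism
    (λ f≋g n → signed-cong n (f≋g n)) (λ f g n → signed-+ n (f n) (g n)) signed-0# alternate-*ₛ alternate-1ₛ
    where
    signed-sum : ∀ n m (f : ℕ → Carrier) → signed n (Σ m f) ≈ Σ m (λ j → signed n (f j))
    signed-sum n zero    f = signed-0# n
    signed-sum n (suc m) f = trans (signed-+ n _ _) (+-congʳ (signed-sum n m f))
    alternate-*ₛ : ∀ f g → alternate (f *ₛ g) ≋ alternate f *ₛ alternate g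
    alternate-*ₛ f g n = trans (signed-sum n (suc n) _) (sum-cong (suc n) λ j j<1+n → sym (trans
      (signed-* j (n ∸ j) (f j) (g (n ∸ j)))
      (reflexive (≡.cong (λ k → signed k (f j * g (n ∸ j))) (m+[n∸m]≡n (≤-pred j<1+n))))))
    alternate-1ₛ : alternate 1ₛ ≋ 1ₛ
    alternate-1ₛ zero    = refl
    alternate-1ₛ (suc n) = signed-0# (suc n)

  alternate-involutive : ∀ f → alternate (alternate f) ≋ f
  alternate-involutive f n = signed-involutive n (f n)

module Matrices {ℓ} (R : CommutativeRing 0ℓ ℓ) where

  open CommutativeRing R
  open RingProperties R

  Matrix : Set
  Matrix = ℕ → ℕ → Carrier

  infix 4 _≈ₘ_ _≈[_]_
  _≈ₘ_ : Rel Matrix ℓ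
  X ≈ₘ Y = ∀ i j → X i j ≈ Y i j

  -- identity is a left unit for mul N only on the first N rows.
  _≈[_]_ : Matrix → ℕ → Matrix → Set ℓ
  X ≈[ N ] Y = ∀ i j → i < N → X i j ≈ Y i j

  firstRows : ℕ → Setoid 0ℓ ℓ
  firstRows N = record
    { Carrier = Matrix
    ; _≈_ = _≈[ N ]_
    ; isEquivalence = record
      { refl = λ _ _ _ → refl
      ; sym = λ X≈Y i j i<N → sym (X≈Y i j i<N)
      ; trans = λ X≈Y Y≈Z i j i<N → trans (X≈Y i j i<N) (Y≈Z i j i<N)
      }
    }

  ≈ₘ⇒≈[] : ∀ {N X Y} → X ≈ₘ Y → X ≈[ N ] Y
  ≈ₘ⇒≈[] X≈Y i j _ = X≈Y i j

  mul : ℕ → Matrix → Matrix → Matrix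
  mul N X Y i j = Σ N (λ l → X i l * Y l j)

  identity : Matrix
  identity i j = if i ≡ᵇ j then 1# else 0#

  pow : ℕ → Matrix → ℕ → Matrix
  pow N X zero    = identity
  pow N X (suc k) = mul N (pow N X k) X

  tr : ℕ → Matrix → Carrier
  tr N X = Σ N (λ i → X i i)

  map : (Carrier → Carrier) → Matrix → Matrix
  map φ X i j = φ (X i j)

  mul-cong : ∀ N {X X′ Y Y′} → X ≈ₘ X′ → Y ≈ₘ Y′ → mul N X Y ≈ₘ mul N X′ Y′
  mul-cong N X≈X′ Y≈Y′ i j = sum-cong N λ l _ → *-cong (X≈X′ i l) (Y≈Y′ l j)

  mul-cong-rows : ∀ N {X X′ Y Y′} → X ≈[ N ] X′ → Y ≈[ N ] Y′ → mul N X Y ≈[ N ] mul N X′ Y′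
  mul-cong-rows N X≈X′ Y≈Y′ i j i<N = sum-cong N λ l l<N → *-cong (X≈X′ i l i<N) (Y≈Y′ l j l<N)

  pow-cong : ∀ N k {X Y} → X ≈ₘ Y → pow N X k ≈ₘ pow N Y k
  pow-cong N zero    X≈Y i j = refl
  pow-cong N (suc k) X≈Y = mul-cong N (pow-cong N k X≈Y) X≈Y

  mul-assoc : ∀ N X Y Z → mul N (mul N X Y) Z ≈ₘ mul N X (mul N Y Z)
  mul-assoc N X Y Z i j = begin
    Σ N (λ l → Σ N (λ m → X i m * Y m l) * Z l j)    ≈⟨ sum-cong N (λ l _ → sum-distribʳ N (Z l j) _) ⟩
    Σ N (λ l → Σ N (λ m → X i m * Y m l * Z l j))    ≈⟨ sum-swap N N _ ⟩
    Σ N (λ m → Σ N (λ l → X i m * Y m l * Z l j))    ≈⟨ sum-cong N (λ m _ → sum-cong N λ l _ → *-assoc _ _ _) ⟩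
    Σ N (λ m → Σ N (λ l → X i m * (Y m l * Z l j)))  ≈⟨ sum-cong N (λ m _ → sum-distribˡ N (X i m) _) ⟨
    Σ N (λ m → X i m * Σ N (λ l → Y m l * Z l j))    ∎
    where open import Relation.Binary.Reasoning.Setoid setoid

  identity-diagonal : ∀ i → identity i i ≈ 1#
  identity-diagonal i with i ≡ᵇ i | ≡⇒≡ᵇ i i ≡.refl
  ... | true | _ = refl

  identity-off-diagonal : ∀ i j → i ≢ j → identity i j ≈ 0#
  identity-off-diagonal i j i≢j with i ≡ᵇ j | ≡ᵇ⇒≡ i j
  ... | false | _   = refl
  ... | true  | i≡j = ⊥-elim (i≢j (i≡j _))

  mul-identityˡ : ∀ N X → mul N identity X ≈[ N ] X
  mul-identityˡ N X i j i<N = trans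
    (sum-pick N i _ i<N λ l _ l≢i → trans (*-congʳ (identity-off-diagonal i l (≡.≢-sym l≢i))) (zeroˡ _))
    (trans (*-congʳ (identity-diagonal i)) (*-identityˡ (X i j)))

  pow-suc-mul : ∀ N X Y k → pow N (mul N X Y) (suc k) ≈[ N ] mul N X (mul N (pow N (mul N Y X) k) Y)
  pow-suc-mul N X Y zero = begin
    mul N identity (mul N X Y)    ≈⟨ mul-identityˡ N (mul N X Y) ⟩
    mul N X Y                     ≈⟨ mul-cong-rows N {X} (λ _ _ _ → refl)
                                         (λ i j i<N → sym (mul-identityˡ N Y i j i<N)) ⟩
    mul N X (mul N identity Y)    ∎
    where open import Relation.Binary.Reasoning.Setoid (firstRows N)
  pow-suc-mul N X Y (suc k) = begin
    mul N (pow N XY (suc k)) XY       ≈⟨ mul-cong-rows N (pow-suc-mul N X Y k) (λ _ _ _ → refl) ⟩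
    mul N (mul N X (mul N P Y)) XY    ≈⟨ ≈ₘ⇒≈[] (mul-assoc N X (mul N P Y) XY) ⟩
    mul N X (mul N (mul N P Y) XY)    ≈⟨ ≈ₘ⇒≈[] (mul-cong N (λ _ _ → refl) (mul-assoc N P Y XY)) ⟩
    mul N X (mul N P (mul N Y XY))    ≈⟨ ≈ₘ⇒≈[] (mul-cong N (λ _ _ → refl)
                                           (mul-cong N (λ _ _ → refl) λ i j → sym (mul-assoc N Y X Y i j))) ⟩
    mul N X (mul N P (mul N YX Y))    ≈⟨ ≈ₘ⇒≈[] (mul-cong N (λ _ _ → refl)
                                           λ i j → sym (mul-assoc N P YX Y i j)) ⟩
    mul N X (mul N (mul N P YX) Y)    ∎
    where
    open import Relation.Binary.Reasoning.Setoid (firstRows N)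
    XY = mul N X Y
    YX = mul N Y X
    P = pow N YX k

  tr-cong : ∀ N {X Y} → X ≈[ N ] Y → tr N X ≈ tr N Y
  tr-cong N X≈Y = sum-cong N λ i i<N → X≈Y i i i<N

  tr-mul-comm : ∀ N X Y → tr N (mul N X Y) ≈ tr N (mul N Y X)
  tr-mul-comm N X Y = trans (sum-swap N N _) (sum-cong N λ l _ → sum-cong N λ i _ → *-comm (X i l) (Y l i))

  tr-pow-mul-comm : ∀ N X Y k → tr N (pow N (mul N X Y) k) ≈ tr N (pow N (mul N Y X) k)
  tr-pow-mul-comm N X Y zero    = refl
  tr-pow-mul-comm N X Y (suc k) = begin
    tr N (pow N (mul N X Y) (suc k))    ≈⟨ tr-cong N (pow-suc-mul N X Y k) ⟩
    tr N (mul N X (mul N P Y))          ≈⟨ tr-mul-comm N X (mul N P Y) ⟩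
    tr N (mul N (mul N P Y) X)          ≈⟨ tr-cong N (≈ₘ⇒≈[] (mul-assoc N P Y X)) ⟩
    tr N (mul N P (mul N Y X))          ∎
    where
    open import Relation.Binary.Reasoning.Setoid setoid
    P = pow N (mul N Y X) k

  module _ {φ} (φ-endo : IsSemiringEndomorphism R φ) where

    open IsSemiringHomomorphism φ-endo

    map-mul : ∀ N X Y → map φ (mul N X Y) ≈ₘ mul N (map φ X) (map φ Y)
    map-mul N X Y i j = trans (sum-homo φ-endo N _) (sum-cong N λ l _ → *-homo _ _)

    map-identity : map φ identity ≈ₘ identity
    map-identity i j with i ≡ᵇ j
    ... | true  = 1#-homo
    ... | false = 0#-homo

    map-pow : ∀ N X k → map φ (pow N X k) ≈ₘ pow N (map φ X) k
    map-pow N X zero    = map-identity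
    map-pow N X (suc k) i j =
      trans (map-mul N (pow N X k) X i j) (mul-cong N {Y = map φ X} (map-pow N X k) (λ _ _ → refl) i j)

    map-tr : ∀ N X → φ (tr N X) ≈ tr N (map φ X)
    map-tr N X = sum-homo φ-endo N _

open ≡ using (refl; cong; cong₂)

mkK-cong : ∀ {a b c d a′ b′ c′ d′} →
  a ≡ a′ → b ≡ b′ → c ≡ c′ → d ≡ d′ → mkK a b c d ≡ mkK a′ b′ c′ d′
mkK-cong refl refl refl refl = refl

infix 8 -K_
-K_ : K → K
-K x = mkK (ℚ.- K.c0 x) (ℚ.- K.c1 x) (ℚ.- K.c2 x) (ℚ.- K.c3 x)

conjugate : K → K
conjugate x = mkK (K.c0 x) (ℚ.- K.c1 x) (K.c2 x) (ℚ.- K.c3 x)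

embed : ℚ → K
embed r = mkK r 0ℚ 0ℚ 0ℚ

module KPolynomial where

  open +-*-Solver using (Polynomial; var; con; _:+_; _:*_; :-_; _:-_; ⟦_⟧; ⟦_⟧↓; prove)

  -- Elements of K whose coordinates are polynomials in the twelve coordinates of three
  -- generic elements x, y, z (laws in fewer variables take 0K for the unused ones).
  record KPoly : Set where
    constructor ⟨_,_,_,_⟩
    field p₀ p₁ p₂ p₃ : Polynomial 12

  open KPoly

  environment : K → K → K → Vec ℚ 12
  environment x y z = let open K in
    c0 x ∷ c1 x ∷ c2 x ∷ c3 x ∷ c0 y ∷ c1 y ∷ c2 y ∷ c3 y ∷ c0 z ∷ c1 z ∷ c2 z ∷ c3 z ∷ []

  ⟦_⟧ₖ ⟦_⟧↓ₖ : KPoly → K → K → K → K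
  ⟦ e ⟧ₖ x y z =
    let ρ = environment x y z in mkK (⟦ p₀ e ⟧ ρ) (⟦ p₁ e ⟧ ρ) (⟦ p₂ e ⟧ ρ) (⟦ p₃ e ⟧ ρ)
  ⟦ e ⟧↓ₖ x y z =
    let ρ = environment x y z in mkK (⟦ p₀ e ⟧↓ ρ) (⟦ p₁ e ⟧↓ ρ) (⟦ p₂ e ⟧↓ ρ) (⟦ p₃ e ⟧↓ ρ)

  -- Opaque, so that no later clause check ever evaluates the normaliser behind a proof.
  opaque
    K-identity : ∀ x y z (e e′ : KPoly) →
      ⟦ e ⟧↓ₖ x y z ≡ ⟦ e′ ⟧↓ₖ x y z → ⟦ e ⟧ₖ x y z ≡ ⟦ e′ ⟧ₖ x y z
    K-identity x y z e e′ eq = mkK-cong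
      (prove ρ (p₀ e) (p₀ e′) (cong K.c0 eq)) (prove ρ (p₁ e) (p₁ e′) (cong K.c1 eq))
      (prove ρ (p₂ e) (p₂ e′) (cong K.c2 eq)) (prove ρ (p₃ e) (p₃ e′) (cong K.c3 eq))
      where ρ : Vec ℚ 12
            ρ = environment x y z

  X Y Z : KPoly
  X = ⟨ var (# 0) , var (# 1) , var (# 2)  , var (# 3)  ⟩
  Y = ⟨ var (# 4) , var (# 5) , var (# 6)  , var (# 7)  ⟩
  Z = ⟨ var (# 8) , var (# 9) , var (# 10) , var (# 11) ⟩

  constant : K → KPoly
  constant x = ⟨ con (K.c0 x) , con (K.c1 x) , con (K.c2 x) , con (K.c3 x) ⟩

  infixl 6 _+ₚ_
  infixl 7 _*ₚ_
  _+ₚ_ _*ₚ_ : KPoly → KPoly → KPoly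
  ⟨ a0 , a1 , a2 , a3 ⟩ +ₚ ⟨ b0 , b1 , b2 , b3 ⟩ = ⟨ a0 :+ b0 , a1 :+ b1 , a2 :+ b2 , a3 :+ b3 ⟩
  ⟨ a0 , a1 , a2 , a3 ⟩ *ₚ ⟨ b0 , b1 , b2 , b3 ⟩ =
    ⟨ a0 :* b0 :- (a1 :* b3 :+ a2 :* b2 :+ a3 :* b1)
    , a0 :* b1 :+ a1 :* b0 :- (a2 :* b3 :+ a3 :* b2)
    , a0 :* b2 :+ a1 :* b1 :+ a2 :* b0 :- a3 :* b3
    , a0 :* b3 :+ a1 :* b2 :+ a2 :* b1 :+ a3 :* b0 ⟩

  -ₚ_ conjugateₚ : KPoly → KPoly
  -ₚ ⟨ a0 , a1 , a2 , a3 ⟩ = ⟨ :- a0 , :- a1 , :- a2 , :- a3 ⟩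
  conjugateₚ ⟨ a0 , a1 , a2 , a3 ⟩ = ⟨ a0 , :- a1 , a2 , :- a3 ⟩

  embedₚ : Polynomial 12 → KPoly
  embedₚ r = ⟨ r , con 0ℚ , con 0ℚ , con 0ℚ ⟩

  scaleₚ : Polynomial 12 → KPoly → KPoly
  scaleₚ r ⟨ a0 , a1 , a2 , a3 ⟩ = ⟨ r :* a0 , r :* a1 , r :* a2 , r :* a3 ⟩

open KPolynomial

K-commutativeRing : CommutativeRing 0ℓ 0ℓ
K-commutativeRing = record
  { Carrier = K ; _≈_ = _≡_ ; _+_ = _+K_ ; _*_ = _*K_ ; -_ = -K_ ; 0# = 0K ; 1# = 1K
  ; isCommutativeRing = record
    { isRing = record
      { +-isAbelianGroup = record
        { isGroup = record
          { isMonoid = record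
            { isSemigroup = record
              { isMagma = record { isEquivalence = ≡.isEquivalence ; ∙-cong = cong₂ _+K_ }
              ; assoc = λ x y z → K-identity x y z (X +ₚ Y +ₚ Z) (X +ₚ (Y +ₚ Z)) refl
              }
            ; identity = (λ x → K-identity x 0K 0K (constant 0K +ₚ X) X refl)
                       , (λ x → K-identity x 0K 0K (X +ₚ constant 0K) X refl)
            }
          ; inverse = (λ x → K-identity x 0K 0K (-ₚ X +ₚ X) (constant 0K) refl)
                    , (λ x → K-identity x 0K 0K (X +ₚ -ₚ X) (constant 0K) refl)
          ; ⁻¹-cong = cong -K_
          }
        ; comm = λ x y → K-identity x y 0K (X +ₚ Y) (Y +ₚ X) refl
        }
      ; *-cong = cong₂ _*K_
      ; *-assoc = λ x y z → K-identity x y z (X *ₚ Y *ₚ Z) (X *ₚ (Y *ₚ Z)) refl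
      ; *-identity = (λ x → K-identity x 0K 0K (constant 1K *ₚ X) X refl)
                   , (λ x → K-identity x 0K 0K (X *ₚ constant 1K) X refl)
      ; distrib = (λ x y z → K-identity x y z (X *ₚ (Y +ₚ Z)) (X *ₚ Y +ₚ X *ₚ Z) refl)
                , (λ x y z → K-identity x y z ((Y +ₚ Z) *ₚ X) (Y *ₚ X +ₚ Z *ₚ X) refl)
      }
    ; *-comm = λ x y → K-identity x y 0K (X *ₚ Y) (Y *ₚ X) refl
    }
  }

τK≡conjugate : ∀ x → τK x ≡ conjugate x
τK≡conjugate x = K-identity x 0K 0K
  (scaleₚ x0 (constant 1K) +ₚ scaleₚ x1 (constant t⁵)
     +ₚ scaleₚ x2 (constant (powK t⁵ 2)) +ₚ scaleₚ x3 (constant (powK t⁵ 3)))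
  (conjugateₚ X) refl
  where
  open KPoly X renaming (p₀ to x0; p₁ to x1; p₂ to x2; p₃ to x3)
  t⁵ = powK tK 5

conjugate-+ : ∀ x y → conjugate (x +K y) ≡ conjugate x +K conjugate y
conjugate-+ x y = K-identity x y 0K (conjugateₚ (X +ₚ Y)) (conjugateₚ X +ₚ conjugateₚ Y) refl

conjugate-* : ∀ x y → conjugate (x *K y) ≡ conjugate x *K conjugate y
conjugate-* x y = K-identity x y 0K (conjugateₚ (X *ₚ Y)) (conjugateₚ X *ₚ conjugateₚ Y) refl

scalK≡embed* : ∀ r x → scalK r x ≡ embed r *K x
scalK≡embed* r x = K-identity x (embed r) 0K (scaleₚ r′ X) (embedₚ r′ *ₚ X) refl
  where r′ = KPoly.p₀ Y

conjugate-tK : conjugate tK ≡ -K tK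
conjugate-tK = refl

conjugate-embed : ∀ r → conjugate (embed r) ≡ embed r
conjugate-embed r = refl

module KR = RingProperties K-commutativeRing
module PS = PowerSeries K-commutativeRing
module XS = PowerSeries PS.commutativeRing
module Mat = Matrices PS.commutativeRing

τK-isSemiringEndomorphism : IsSemiringEndomorphism K-commutativeRing τK
τK-isSemiringEndomorphism = KR.isSemiringEndomorphism (cong τK)
  (λ x y → ≡.trans (τK≡conjugate (x +K y))
             (≡.trans (conjugate-+ x y) (≡.sym (cong₂ _+K_ (τK≡conjugate x) (τK≡conjugate y)))))
  (τK≡conjugate 0K)
  (λ x y → ≡.trans (τK≡conjugate (x *K y))
             (≡.trans (conjugate-* x y) (≡.sym (cong₂ _*K_ (τK≡conjugate x) (τK≡conjugate y)))))
  (τK≡conjugate 1K)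

τPS-isSemiringEndomorphism : IsSemiringEndomorphism PS.commutativeRing τPS
τPS-isSemiringEndomorphism = PS.map-isSemiringEndomorphism τK-isSemiringEndomorphism

τK-0K : ∀ n → τK 0K ≡ KR.signed n 0K
τK-0K n = ≡.trans (τK≡conjugate 0K) (≡.sym (KR.signed-0# n))

τK-powK-tK : ∀ n → τK (powK tK n) ≡ KR.signed n (powK tK n)
τK-powK-tK zero    = τK≡conjugate 1K
τK-powK-tK (suc n) = begin
  τK (tⁿ *K tK)                ≡⟨ *-homo tⁿ tK ⟩
  τK tⁿ *K τK tK               ≡⟨ cong₂ _*K_ (τK-powK-tK n) (≡.trans (τK≡conjugate tK) conjugate-tK) ⟩
  KR.signed n tⁿ *K (-K tK)    ≡⟨ -‿distribʳ-* (KR.signed n tⁿ) tK ⟨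
  -K (KR.signed n tⁿ *K tK)    ≡⟨ cong -K_ (KR.signed-*ˡ n tⁿ tK) ⟩
  -K KR.signed n (tⁿ *K tK)    ∎
  where
  open ≡.≡-Reasoning
  open KR.IsSemiringHomomorphism τK-isSemiringEndomorphism
  open import Algebra.Properties.Ring (CommutativeRing.ring K-commutativeRing) using (-‿distribʳ-*)
  tⁿ = powK tK n

τK-scalK-powK-tK : ∀ r n → τK (scalK r (powK tK n)) ≡ KR.signed n (scalK r (powK tK n))
τK-scalK-powK-tK r n = begin
  τK (scalK r tⁿ)                ≡⟨ cong τK (scalK≡embed* r tⁿ) ⟩
  τK (embed r *K tⁿ)             ≡⟨ *-homo (embed r) tⁿ ⟩
  τK (embed r) *K τK tⁿ          ≡⟨ cong₂ _*K_ (≡.trans (τK≡conjugate (embed r)) (conjugate-embed r))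
                                                (τK-powK-tK n) ⟩
  embed r *K KR.signed n tⁿ      ≡⟨ KR.signed-*ʳ n (embed r) tⁿ ⟩
  KR.signed n (embed r *K tⁿ)    ≡⟨ cong (KR.signed n) (scalK≡embed* r tⁿ) ⟨
  KR.signed n (scalK r tⁿ)       ∎
  where
  open ≡.≡-Reasoning
  open KR.IsSemiringHomomorphism τK-isSemiringEndomorphism
  tⁿ = powK tK n

-- Conversion checking unfolds τK, and with it the arithmetic of ℚ, as soon as it has to
-- compare τK at two different arguments.  The τ-lemmas below are therefore stated with
-- τK applied to exactly the term in the goal, and the definitions of Esub, F and Amat
-- are unfolded by explicit transport instead.
if-elim : ∀ {A : Set} (P : A → Set) b {x y : A} z → z ≡ (if b then x else y) → P x → P y → P z
if-elim P true  _ refl px _  = px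
if-elim P false _ refl _  py = py

τPS-Esub : ∀ m i → τPS (Esub m i) PS.≋ PS.alternate (Esub m i)
τPS-Esub m i n = if-elim (λ y → τK y ≡ KR.signed n y) (m ℕ.* n ≡ᵇ i) (Esub m i n) refl
  (τK-scalK-powK-tK (ahE n) n) (τK-0K n)

F≡Esub-product : F ≡ (Esub 8 XS.*ₛ Esub 6) XS.*ₛ Esub 2
F≡Esub-product = refl

τPS-F : ∀ i → τPS (F i) PS.≋ PS.alternate (F i)
τPS-F = ≡.subst (λ G → ∀ i → τPS (G i) PS.≋ PS.alternate (G i)) (≡.sym F≡Esub-product) $
  XS.homomorphisms-agree-*ₛ τPS-isSemiringEndomorphism PS.alternate-isSemiringEndomorphism
    {Esub 8 XS.*ₛ Esub 6} {Esub 2}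
    (XS.homomorphisms-agree-*ₛ τPS-isSemiringEndomorphism PS.alternate-isSemiringEndomorphism
       {Esub 8} {Esub 6} (τPS-Esub 8) (τPS-Esub 6))
    (τPS-Esub 2)

τPS-Amat : ∀ N i j → τPS (Amat N i j) PS.≋ PS.alternate (Amat N i j)
τPS-Amat N i j = if-elim (λ f → τPS f PS.≋ PS.alternate f) (suc j ℕ.≤ᵇ 5 ℕ.* suc i) (Amat N i j) refl
  (τPS-F (5 ℕ.* suc i ∸ suc j)) τK-0K

alternate-Mmat : ∀ N → Mat.map PS.alternate (Mmat N) Mat.≈ₘ Mat.mul N (τMat (Amat N)) (Amat N)
alternate-Mmat N i j = trans (Mat.map-mul PS.alternate-isSemiringEndomorphism N A (τMat A) i j)
  (Mat.mul-cong N {Mat.map PS.alternate A} {τMat A} {Mat.map PS.alternate (τMat A)} {A}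
     (λ i′ j′ → sym (τPS-Amat N i′ j′)) alternate-τA i j)
  where
  open CommutativeRing PS.commutativeRing using (sym; trans)
  open PS.Ring[[π]].IsSemiringHomomorphism PS.alternate-isSemiringEndomorphism using (⟦⟧-cong)
  A = Amat N
  alternate-τA : Mat.map PS.alternate (τMat A) Mat.≈ₘ A
  alternate-τA i j = trans (⟦⟧-cong (τPS-Amat N i j)) (PS.alternate-involutive (A i j))

alternate-fixes-tr-pow : ∀ N k →
  PS.alternate (Mat.tr N (Mat.pow N (Mmat N) k)) PS.≋ Mat.tr N (Mat.pow N (Mmat N) k)
alternate-fixes-tr-pow N k = begin
  PS.alternate (Mat.tr N (Mat.pow N M k))            ≈⟨ Mat.map-tr ε-endo N (Mat.pow N M k) ⟩
  Mat.tr N (Mat.map PS.alternate (Mat.pow N M k))    ≈⟨ Mat.tr-cong N (Mat.≈ₘ⇒≈[] (Mat.map-pow ε-endo N M k)) ⟩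
  Mat.tr N (Mat.pow N (Mat.map PS.alternate M) k)    ≈⟨ Mat.tr-cong N
                                                          (Mat.≈ₘ⇒≈[] (Mat.pow-cong N k (alternate-Mmat N))) ⟩
  Mat.tr N (Mat.pow N (Mat.mul N (τMat A) A) k)      ≈⟨ Mat.tr-pow-mul-comm N (τMat A) A k ⟩
  Mat.tr N (Mat.pow N M k)                           ∎
  where
  open import Relation.Binary.Reasoning.Setoid (CommutativeRing.setoid PS.commutativeRing)
  ε-endo = PS.alternate-isSemiringEndomorphism
  A = Amat N
  M = Mmat N

-- Defs' 1PS and PS.1ₛ are extensionally but not definitionally equal, so Defs' matrix
-- powers agree with Mat.pow only entrywise.
1PS≋1ₛ : 1PS PS.≋ PS.1ₛ
1PS≋1ₛ zero    = refl
1PS≋1ₛ (suc n) = refl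

idMat≈identity : idMat Mat.≈ₘ Mat.identity
idMat≈identity i j with i ≡ᵇ j
... | true  = 1PS≋1ₛ
... | false = λ _ → refl

mpow≈pow : ∀ N X k → mpow N X k Mat.≈ₘ Mat.pow N X k
mpow≈pow N X zero    = idMat≈identity
mpow≈pow N X (suc k) = Mat.mul-cong N {mpow N X k} {Mat.pow N X k} {X} {X} (mpow≈pow N X k) (λ _ _ _ → refl)

trMk≋tr-pow : ∀ N k → trMk N k PS.≋ Mat.tr N (Mat.pow N (Mmat N) k)
trMk≋tr-pow N k = Mat.tr-cong N (Mat.≈ₘ⇒≈[] (mpow≈pow N (Mmat N) k))

ℚ-self-negating : ∀ a → a ≡ ℚ.- a → a ≡ 0ℚ
ℚ-self-negating a a≡-a = begin
  a                      ≡⟨ solve 1 (λ a → a := con ½ :* (a :+ a)) refl a ⟩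
  ½ ℚ.* (a ℚ.+ a)        ≡⟨ cong (λ b → ½ ℚ.* (a ℚ.+ b)) a≡-a ⟩
  ½ ℚ.* (a ℚ.+ ℚ.- a)    ≡⟨ cong (½ ℚ.*_) (ℚ.+-inverseʳ a) ⟩
  ½ ℚ.* 0ℚ               ≡⟨ ℚ.*-zeroʳ ½ ⟩
  0ℚ                     ∎
  where
  open ≡.≡-Reasoning
  open +-*-Solver using (solve; _:=_; con; _:*_; _:+_)

K-self-negating : ∀ x → x ≡ -K x → x ≡ 0K
K-self-negating x x≡-x = mkK-cong
  (ℚ-self-negating _ (cong K.c0 x≡-x)) (ℚ-self-negating _ (cong K.c1 x≡-x))
  (ℚ-self-negating _ (cong K.c2 x≡-x)) (ℚ-self-negating _ (cong K.c3 x≡-x))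

odd-coefficients-vanish : ∀ N k n → n % 2 ≡ 1 → trMk N k n ≡ 0K
odd-coefficients-vanish N k n odd = K-self-negating (trMk N k n) $ begin
  trMk N k n          ≡⟨ trMk≋tr-pow N k n ⟩
  T n                 ≡⟨ alternate-fixes-tr-pow N k n ⟨
  KR.signed n (T n)   ≡⟨ KR.signed-odd n (T n) odd ⟩
  -K T n              ≡⟨ cong -K_ (trMk≋tr-pow N k n) ⟨
  -K trMk N k n       ∎
  where
  open ≡.≡-Reasoning
  T = Mat.tr N (Mat.pow N (Mmat N) k)

proposition4p12 : (k : ℕ) → 1 ≤ k → (n : ℕ) → n % 2 ≡ 1 →
    ∃[ N₀ ] ((N : ℕ) → N₀ ≤ N → trMk N k n ≡ 0K)
proposition4p12 k _ n odd = 0 , λ N _ → odd-coefficients-vanish N k n odd
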